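{- Let $G=(V,E,c)$ be an edge-coloured graph whose underlying undirected graph is connected. Then any two equivalence classes $P,Q$ of the partition of $V$ under the vertex bisimulation relation $\sim_G$ satisfy $|P|=|Q|$.
   Context: An edge-coloured graph over a linearly ordered colour set $(\mathcal C,<_{\mathcal C})$ is a triple $G=(V,E,c)$ with the following properties. The vertex set is $V=\{1,\dots,k\}$. The edge set $E\subseteq V\times V$ consists of directed edges. The map $c:E\to\mathcal C$ is a colouring such that, for every vertex $v$, $c$ is injective on the out-edges of $v$ and injective on the in-edges of $v$. The states are $S_G=V\cup V_\bot$, where $V_\bot=\{\bot_v:v\in V\}$ is a set of fresh states. The alphabet is $\Sigma_G=\mathrm{image}(c)\cup\{x^-:x\in\mathrm{image}(c)\}$, where each $x^-$ is a fresh "reverse" symbol. The transition function $\delta_G:S_G\times\Sigma_G\to S_G$ is defined as follows: - $\delta_G(s,x)=v'$ if $(s,v')\in E$ and $c(s,v')=x$; - $\delta_G(s,x^-)=v$ if $(v,s)\in E$ and $c(v,s)=x$; - otherwise $\delta_G(s,x)=\bot_s$ if $s\in V$, and $\delta_G(s,x)=s$ if $s\in V_\bot$. Extend $\delta_G$ to words by $\hat\delta_G(s,\varepsilon)=s$ and $\hat\delta_G(s,xw)=\hat\delta_G(\delta_G(s,x),w)$. Vertex bisimulation $\sim_G\subseteq S_G\times S_G$ is defined by: $s\sim_G s'$ iff for every word $w\in\Sigma_G^*$, $\hat\delta_G(s,w)\in V\iff\hat\delta_G(s',w)\in V$. The partition in the claim is that of $V$ into the classes of $\sim_G$ restricted to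 $V$. -}

module Defs where

open import Data.Nat using (ℕ)
open import Data.Fin using (Fin)
open import Data.Fin.Properties using (any?)
open import Data.Maybe using (Maybe; just; nothing)
open import Data.Maybe.Properties using () renaming (≡-dec to maybe-≡-dec)
open import Data.Bool using (Bool; true; false)
open import Data.Product using (Σ; ∃; ∃₂; _×_; _,_)
open import Data.Sum using (_⊎_; inj₁; inj₂)
open import Data.List using (List; []; _∷_)
open import Data.Unit using (⊤)
open import Data.Empty using (⊥)
open import Function.Bundles using (_⇔_)
open import Relation.Binary.PropositionalEquality using (_≡_)
open import Relation.Binary.Definitions using (DecidableEquality)
open import Relation.Binary.Construct.Closure.ReflexiveTransitive using (Star)
open import Relation.Nullary using (yes; no)

-- An edge-coloured graph with vertex set V = Fin k over colour set C.
-- col u v ≡ just x  means (u,v) ∈ E and c(u,v) = x;  col u v ≡ nothing  means (u,v) ∉ E.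
record ECGraph (C : Set) : Set where
  field
    k     : ℕ
    col   : Fin k → Fin k → Maybe C
    outInj : ∀ v {u u' x} → col v u ≡ just x → col v u' ≡ just x → u ≡ u'
    inInj  : ∀ v {u u' x} → col u v ≡ just x → col u' v ≡ just x → u ≡ u'

module _ {C : Set} (G : ECGraph C) where
  open ECGraph G

  Edge : Fin k → Fin k → Set
  Edge u v = ∃ λ x → col u v ≡ just x

  UAdj : Fin k → Fin k → Set
  UAdj u v = Edge u v ⊎ Edge v u

  Connected : Set
  Connected = ∀ u v → Star UAdj u v

  InImage : C → Set
  InImage x = ∃₂ λ u v → col u v ≡ just x

  -- Alphabet Σ_G: a colour in image(c) together with a direction
  -- (true = forward symbol x, false = reverse symbol x⁻).
  Letter : Set
  Letter = (Σ C InImage) × Bool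

  -- States S_G = V ∪ V_⊥ : inj₁ v is the vertex v, inj₂ v is ⊥_v.
  State : Set
  State = Fin k ⊎ Fin k

  IsVertex : State → Set
  IsVertex (inj₁ _) = ⊤
  IsVertex (inj₂ _) = ⊥

  module _ (_≟_ : DecidableEquality C) where

    private
      _≟M_ : DecidableEquality (Maybe C)
      _≟M_ = maybe-≡-dec _≟_

    δ : State → Letter → State
    δ (inj₂ s) _ = inj₂ s
    δ (inj₁ s) ((x , _) , true) with any? (λ v' → col s v' ≟M just x)
    ... | yes (v' , _) = inj₁ v'
    ... | no _ = inj₂ s
    δ (inj₁ s) ((x , _) , false) with any? (λ v → col v s ≟M just x)
    ... | yes (v , _) = inj₁ v
    ... | no _ = inj₂ s

    δ̂ : State → List Letter → State
    δ̂ s [] = s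
    δ̂ s (a ∷ w) = δ̂ (δ s a) w

    _∼_ : State → State → Set
    s ∼ s' = ∀ (w : List Letter) → IsVertex (δ̂ s w) ⇔ IsVertex (δ̂ s' w)

module Submission where

-- Reading a letter l is a partial injection on vertices: a vertex is reached by at most one
-- in-edge and at most one out-edge of each colour. Bisimilarity is preserved by reading l,
-- and a state bisimilar to a vertex is a vertex, so if l leads from a to b then l maps the
-- class of a injectively into the class of b. Walking along an undirected path from u to v
-- (forward letters for forward edges, reverse letters for backward ones) therefore embeds the
-- class of u into that of v, and by symmetry the two classes have the same size.

open import Defs
open import Data.Fin using (Fin; zero; suc)
open import Data.Fin.Subset using (Subset; _∈_; ∣_∣; _-_; inside; outside)
open import Data.Fin.Subset.Properties using (x∈p⇒∣p-x∣<∣p∣; x∈p∧x≢y⇒x∈p-y)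
open import Data.Fin.Properties using (any?; suc-injective; 0≢1+n)
open import Data.Vec using ([]; _∷_; here; there)
open import Data.Sum using (inj₁; inj₂)
open import Data.Product using (_,_)
open import Data.Nat using (ℕ; _≤_; z≤n; s≤s)
open import Data.Nat.Properties using (≤-antisym; ≤-trans)
open import Data.Maybe using (just)
open import Data.Maybe.Properties using () renaming (≡-dec to maybe-≡-dec)
open import Data.Bool using (true; false)
import Data.List as List
open import Data.Unit using (tt)
open import Data.Empty using (⊥-elim)
open import Function.Bundles using (_⇔_; mk⇔; Equivalence)
open import Relation.Binary.PropositionalEquality using (_≡_; refl; sym; trans; cong; subst)
open import Relation.Binary.Structures using (IsStrictTotalOrder)
open import Relation.Binary.Core using (Rel)
open import Relation.Binary.Definitions using (DecidableEquality)
open import Relation.Binary.Construct.Closure.ReflexiveTransitive using (Star; ε; _◅_)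
open import Relation.Unary using (Pred)
open import Relation.Nullary using (yes; no)
open import Level using (Level; _⊔_; 0ℓ)

private
  variable
    ℓ₁ ℓ₂ ℓ₃ : Level
    m n o : ℕ

record _↪_ (A : Pred (Fin m) ℓ₁) (B : Pred (Fin n) ℓ₂) : Set (ℓ₁ ⊔ ℓ₂) where
  field
    map       : Fin m → Fin n
    maps-into : ∀ {x} → A x → B (map x)
    injective : ∀ {x y} → A x → A y → map x ≡ map y → x ≡ y
open _↪_

↪-refl : {A : Pred (Fin m) ℓ₁} → A ↪ A
↪-refl = record { map = λ x → x ; maps-into = λ Ax → Ax ; injective = λ _ _ eq → eq }

↪-trans : {A : Pred (Fin m) ℓ₁} {B : Pred (Fin n) ℓ₂} {C : Pred (Fin o) ℓ₃} →
  A ↪ B → B ↪ C → A ↪ C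
↪-trans f g = record
  { map       = λ x → map g (map f x)
  ; maps-into = λ Ax → maps-into g (maps-into f Ax)
  ; injective = λ Ax Ay eq →
      injective f Ax Ay (injective g (maps-into f Ax) (maps-into f Ay) eq)
  }

↪-mono : {A A′ : Pred (Fin m) ℓ₁} {B B′ : Pred (Fin n) ℓ₂} →
  (∀ {x} → A′ x → A x) → (∀ {x} → B x → B′ x) → A ↪ B → A′ ↪ B′
↪-mono A′⊆A B⊆B′ f = record
  { map       = map f
  ; maps-into = λ A′x → B⊆B′ (maps-into f (A′⊆A A′x))
  ; injective = λ A′x A′y → injective f (A′⊆A A′x) (A′⊆A A′y)
  }

-- Induction on p: its first element, if present, uses up the point it is sent to in q.
↪⇒∣p∣≤∣q∣ : {p : Subset m} {q : Subset n} → (_∈ p) ↪ (_∈ q) → ∣ p ∣ ≤ ∣ q ∣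
↪⇒∣p∣≤∣q∣ {p = []} f = z≤n
↪⇒∣p∣≤∣q∣ {p = outside ∷ p} f = ↪⇒∣p∣≤∣q∣ (↪-trans suc-↪ f)
  where
  suc-↪ : (_∈ p) ↪ (_∈ outside ∷ p)
  suc-↪ = record { map = suc ; maps-into = there ; injective = λ _ _ → suc-injective }
↪⇒∣p∣≤∣q∣ {p = inside ∷ p} {q = q} f =
  ≤-trans (s≤s (↪⇒∣p∣≤∣q∣ rest)) (x∈p⇒∣p-x∣<∣p∣ (maps-into f here))
  where
  rest : (_∈ p) ↪ (_∈ q - map f zero)
  rest = record
    { map       = λ x → map f (suc x)
    ; maps-into = λ x∈p → x∈p∧x≢y⇒x∈p-y (maps-into f (there x∈p))
                            (λ eq → 0≢1+n (sym (injective f (there x∈p) here eq)))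
    ; injective = λ x∈p y∈p eq → suc-injective (injective f (there x∈p) (there y∈p) eq)
    }

module BisimulationClasses {C : Set} (G : ECGraph C) (_≟_ : DecidableEquality C) where
  open ECGraph G

  private
    step : State G → Letter G → State G
    step = δ G _≟_

    _≈_ : State G → State G → Set
    _≈_ = _∼_ G _≟_

  Class : Fin k → Pred (Fin k) 0ℓ
  Class a w = inj₁ w ≈ inj₁ a

  forward-step : ∀ {s t x} (p : InImage G x) →
    step (inj₁ s) ((x , p) , true) ≡ inj₁ t ⇔ col s t ≡ just x
  forward-step {s} {t} {x} p with any? (λ v → maybe-≡-dec _≟_ (col s v) (just x))
  ... | yes (v , e) = mk⇔ (λ { refl → e }) (λ e′ → cong inj₁ (outInj s e e′))
  ... | no ¬e       = mk⇔ (λ ()) (λ e′ → ⊥-elim (¬e (t , e′)))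

  backward-step : ∀ {s t x} (p : InImage G x) →
    step (inj₁ s) ((x , p) , false) ≡ inj₁ t ⇔ col t s ≡ just x
  backward-step {s} {t} {x} p with any? (λ v → maybe-≡-dec _≟_ (col v s) (just x))
  ... | yes (v , e) = mk⇔ (λ { refl → e }) (λ e′ → cong inj₁ (inInj s e e′))
  ... | no ¬e       = mk⇔ (λ ()) (λ e′ → ⊥-elim (¬e (t , e′)))

  step-injective : ∀ l {w w′ t} →
    step (inj₁ w) l ≡ inj₁ t → step (inj₁ w′) l ≡ inj₁ t → w ≡ w′
  step-injective ((x , p) , true) e e′ =
    inInj _ (Equivalence.to (forward-step p) e) (Equivalence.to (forward-step p) e′)
  step-injective ((x , p) , false) e e′ =
    outInj _ (Equivalence.to (backward-step p) e) (Equivalence.to (backward-step p) e′)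

  ≈-step : ∀ l {s t} → s ≈ t → step s l ≈ step t l
  ≈-step l s≈t w = s≈t (l List.∷ w)

  -- The value at a ⊥-state is junk; it is only used where the state is a vertex.
  vertexOf : State G → Fin k
  vertexOf (inj₁ v) = v
  vertexOf (inj₂ v) = v

  ≈-vertex : ∀ {s v} → s ≈ inj₁ v → s ≡ inj₁ (vertexOf s)
  ≈-vertex {inj₁ _} _   = refl
  ≈-vertex {inj₂ _} s≈v = ⊥-elim (Equivalence.from (s≈v List.[]) tt)

  step-↪ : ∀ l {a b} → step (inj₁ a) l ≡ inj₁ b → Class a ↪ Class b
  step-↪ l {a} {b} a↦b = record
    { map       = λ w → vertexOf (step (inj₁ w) l)
    ; maps-into = λ w∈a → subst (_≈ inj₁ b) (lands w∈a) (related w∈a)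
    ; injective = λ w∈a w′∈a eq →
        step-injective l (lands w∈a) (trans (lands w′∈a) (cong inj₁ (sym eq)))
    }
    where
    related : ∀ {w} → Class a w → step (inj₁ w) l ≈ inj₁ b
    related w∈a = subst (_ ≈_) a↦b (≈-step l w∈a)
    lands : ∀ {w} → Class a w → step (inj₁ w) l ≡ inj₁ (vertexOf (step (inj₁ w) l))
    lands w∈a = ≈-vertex (related w∈a)

  adjacent-↪ : ∀ {a b} → UAdj G a b → Class a ↪ Class b
  adjacent-↪ {a} {b} (inj₁ (x , e)) =
    step-↪ ((x , (a , b , e)) , true) (Equivalence.from (forward-step (a , b , e)) e)
  adjacent-↪ {a} {b} (inj₂ (x , e)) =
    step-↪ ((x , (b , a , e)) , false) (Equivalence.from (backward-step (b , a , e)) e)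

  connected-↪ : ∀ {a b} → Star (UAdj G) a b → Class a ↪ Class b
  connected-↪ ε            = ↪-refl
  connected-↪ (adj ◅ path) = ↪-trans (adjacent-↪ adj) (connected-↪ path)

proposition15 : {C : Set} {_<_ : Rel C 0ℓ} (ord : IsStrictTotalOrder _≡_ _<_)
    (G : ECGraph C) → Connected G →
    (u v : Fin (ECGraph.k G)) (P Q : Subset (ECGraph.k G)) →
    (∀ w → (w ∈ P) ⇔ _∼_ G (IsStrictTotalOrder._≟_ ord) (inj₁ w) (inj₁ u)) →
    (∀ w → (w ∈ Q) ⇔ _∼_ G (IsStrictTotalOrder._≟_ ord) (inj₁ w) (inj₁ v)) →
    ∣ P ∣ ≡ ∣ Q ∣
proposition15 ord G connected u v P Q P≡[u] Q≡[v] =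
  ≤-antisym (↪⇒∣p∣≤∣q∣ (classes-↪ P≡[u] Q≡[v] (connected u v)))
            (↪⇒∣p∣≤∣q∣ (classes-↪ Q≡[v] P≡[u] (connected v u)))
  where
  open BisimulationClasses G (IsStrictTotalOrder._≟_ ord)
  classes-↪ : ∀ {a b R S} → (∀ w → (w ∈ R) ⇔ Class a w) → (∀ w → (w ∈ S) ⇔ Class b w) →
    Star (UAdj G) a b → (_∈ R) ↪ (_∈ S)
  classes-↪ R≡[a] S≡[b] path =
    ↪-mono (Equivalence.to (R≡[a] _)) (Equivalence.from (S≡[b] _)) (connected-↪ path)
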